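{- Let $n \geq 2$ and let $q$ be a prime power. There exists an $(n,1)$-set of size $(q-1)^{n-1}$ in $\mathrm{PG}(n,q)$, i.e. a set of $(q-1)^{n-1}$ points of $\mathrm{PG}(n,q)$ no $n+1$ of which are collinear.
   Context: $\mathrm{PG}(n,q)$ is the projective space whose points and lines are the $1$- and $2$-dimensional subspaces of $\mathbb{F}_q^{n+1}$. An $(r,s)$-set is a set of points such that every $s$-dimensional projective subspace contains at most $r$ of its points; so an $(n,1)$-set is a point set meeting every line in at most $n$ points. -}

module Defs where

open import Level using (Level; _⊔_) renaming (suc to lsuc)
open import Data.Nat using (ℕ; suc; _^_; _∸_; _≥_; _≤_)
open import Data.Nat.Primality using (Prime)
open import Data.Fin using (Fin)
open import Data.Product using (Σ; ∃; _×_; _,_)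
open import Relation.Binary.PropositionalEquality using (_≡_)
open import Relation.Nullary using (¬_)
open import Algebra.Bundles using (CommutativeRing)

IsPrimePower : ℕ → Set
IsPrimePower q = Σ ℕ λ p → Σ ℕ λ k → Prime p × k ≥ 1 × q ≡ p ^ k

record Field (c ℓ : Level) : Set (lsuc (c ⊔ ℓ)) where
  field
    commRing : CommutativeRing c ℓ
  open CommutativeRing commRing public
  field
    0≉1     : ¬ (0# ≈ 1#)
    inverse : ∀ x → ¬ (x ≈ 0#) → Σ Carrier λ y → x * y ≈ 1#

HasOrder : ∀ {c ℓ} → Field c ℓ → ℕ → Set (c ⊔ ℓ)
HasOrder F q = Σ (Fin q → Carrier) λ e →
    (∀ i j → e i ≈ e j → i ≡ j) × (∀ x → Σ (Fin q) λ i → e i ≈ x)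
  where open Field F

module ProjectiveSpace {c ℓ} (F : Field c ℓ) (n : ℕ) where
  open Field F

  Vector : Set c
  Vector = Fin (suc n) → Carrier

  IsZero : Vector → Set ℓ
  IsZero v = ∀ i → v i ≈ 0#

  Proportional : Vector → Vector → Set (c ⊔ ℓ)
  Proportional u v = Σ Carrier λ a → ∀ i → u i ≈ a * v i

  LinIndep : Vector → Vector → Set (c ⊔ ℓ)
  LinIndep u v = ∀ a b → (∀ i → (a * u i) + (b * v i) ≈ 0#) → (a ≈ 0#) × (b ≈ 0#)

  InSpan : Vector → Vector → Vector → Set (c ⊔ ℓ)
  InSpan u v w = Σ Carrier λ a → Σ Carrier λ b → ∀ i → w i ≈ (a * u i) + (b * v i)

  IsPointSet : (N : ℕ) → (Fin N → Vector) → Set (c ⊔ ℓ)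
  IsPointSet N P = (∀ k → ¬ IsZero (P k)) × (∀ k l → Proportional (P k) (P l) → k ≡ l)

  AtMostOnEachLine : (r N : ℕ) → (Fin N → Vector) → Set (c ⊔ ℓ)
  AtMostOnEachLine r N P = ∀ (u v : Vector) → LinIndep u v →
    (f : Fin (suc r) → Fin N) → (∀ i j → f i ≡ f j → i ≡ j) →
    ¬ (∀ i → InSpan u v (P (f i)))

{-# OPTIONS --safe #-}
-- Take the (q − 1)ⁿ⁻¹ points (1, x₁, …, xₙ) with x₁ x₂ ⋯ xₙ = 1: x₂, …, xₙ ∈ F* are free and
-- x₁ is then determined.  A line through two of them is not contained in x₀ = 0, so in the
-- chart x₀ = 1 it is an affine line p + t·w, and its points of the set are the roots of
-- t ↦ ∏ⱼ (pⱼ + t wⱼ) − 1, a polynomial of degree ≤ n.  With n + 1 roots it vanishes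
-- identically; but if some wⱼ ≠ 0 the product vanishes at t = − pⱼ / wⱼ.  So w = 0, which is
-- not a line.
module Submission where

open import Defs
open import Level using (Level; _⊔_)
open import Data.Nat using (ℕ; _^_; _∸_; _≥_; zero; suc)
open import Data.Fin using (Fin; zero; suc; punchIn; finToFun; funToFin; combine)
open import Data.Fin.Properties
  using (punchIn-injective; punchInᵢ≢i; funToFin-finToFin; suc-injective)
  renaming (_≟_ to _≟ᶠ_)
open import Data.Product using (Σ; _×_; _,_; proj₁; proj₂)
open import Function using (_∘_)
open import Data.Empty using (⊥-elim)
open import Relation.Binary.PropositionalEquality as ≡ using (_≡_; _≗_)
open import Relation.Nullary using (¬_; Dec; yes; no)
import Algebra.Properties.Ring as RingProperties
import Algebra.Properties.Monoid.Sum as MonoidSum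
import Algebra.Solver.Ring.NaturalCoefficients.Default as SemiringSolver
import Relation.Binary.Reasoning.Setoid as SetoidReasoning

funToFin-cong : ∀ {m r} {f g : Fin m → Fin r} → f ≗ g → funToFin f ≡ funToFin g
funToFin-cong {zero}  _   = ≡.refl
funToFin-cong {suc m} f≗g = ≡.cong₂ combine (f≗g zero) (funToFin-cong (f≗g ∘ suc))

finToFun-injective : ∀ {m r} {k l : Fin (r ^ m)} → finToFun {r} {m} k ≗ finToFun l → k ≡ l
finToFun-injective {m} {r} {k} {l} k≗l = begin
  k                                ≡⟨ funToFin-finToFin {m} {r} k ⟨
  funToFin (finToFun {r} {m} k)    ≡⟨ funToFin-cong k≗l ⟩
  funToFin (finToFun {r} {m} l)    ≡⟨ funToFin-finToFin {m} {r} l ⟩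
  l                                ∎
  where open ≡.≡-Reasoning

module _ {c ℓ} (F : Field c ℓ) where
  open Field F hiding (zero)
  open RingProperties ring using (x∙y⁻¹≈ε⇒x≈y; //-rightDividesˡ; +-cancelˡ)
  open MonoidSum *-monoid using () renaming (sum to ∏; sum-cong-≋ to ∏-cong)
  open SemiringSolver commutativeSemiring using (solve; _:=_; _:+_; _:*_)
  open SetoidReasoning setoid

  x≉0∧xy≈0⇒y≈0 : ∀ {x y} → ¬ (x ≈ 0#) → x * y ≈ 0# → y ≈ 0#
  x≉0∧xy≈0⇒y≈0 {x} {y} x≉0 xy≈0 with inverse x x≉0
  ... | x⁻¹ , xx⁻¹≈1 = begin
    y              ≈⟨ *-identityˡ y ⟨
    1# * y         ≈⟨ *-congʳ (trans (sym xx⁻¹≈1) (*-comm x x⁻¹)) ⟩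
    x⁻¹ * x * y    ≈⟨ *-assoc x⁻¹ x y ⟩
    x⁻¹ * (x * y)  ≈⟨ *-congˡ xy≈0 ⟩
    x⁻¹ * 0#       ≈⟨ zeroʳ x⁻¹ ⟩
    0#             ∎

  t≈r+[t-r] : ∀ t r → t ≈ r + (t - r)
  t≈r+[t-r] t r = sym (trans (+-comm r (t - r)) (//-rightDividesˡ r t))

  ∏≈0 : ∀ {m} (f : Fin m → Carrier) j → f j ≈ 0# → ∏ f ≈ 0#
  ∏≈0 f zero    fj≈0 = trans (*-congʳ fj≈0) (zeroˡ _)
  ∏≈0 f (suc j) fj≈0 = trans (*-congˡ (∏≈0 (f ∘ suc) j fj≈0)) (zeroʳ _)

  ∏≉0 : ∀ {m} (f : Fin m → Carrier) → (∀ j → ¬ (f j ≈ 0#)) → ¬ (∏ f ≈ 0#)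
  ∏≉0 {zero}  f f≉0 1≈0 = 0≉1 (sym 1≈0)
  ∏≉0 {suc m} f f≉0 ∏≈0 = ∏≉0 (f ∘ suc) (f≉0 ∘ suc) (x≉0∧xy≈0⇒y≈0 (f≉0 zero) ∏≈0)

  -- Polynomial functions of degree ≤ n, given by the factor theorem at every point:
  -- g t = g r + (t − r)·h t with h of degree < n.  The difference t − r is passed
  -- as d with t ≈ r + d, so every identity below is subtraction-free.
  HasDegree≤ : ℕ → (Carrier → Carrier) → Set (c ⊔ ℓ)
  HasDegree≤ zero    g = ∀ s t → g s ≈ g t
  HasDegree≤ (suc n) g = ∀ r → Σ (Carrier → Carrier) λ h →
    HasDegree≤ n h × (∀ t d → t ≈ r + d → g t ≈ g r + d * h t)

  const-degree≤ : ∀ n a → HasDegree≤ n (λ _ → a)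
  const-degree≤ zero    a s t = refl
  const-degree≤ (suc n) a r =
    (λ _ → 0#) , const-degree≤ n 0# , λ t d _ → sym (trans (+-congˡ (zeroʳ d)) (+-identityʳ a))

  +-degree≤ : ∀ n {g₁ g₂} → HasDegree≤ n g₁ → HasDegree≤ n g₂ → HasDegree≤ n (λ t → g₁ t + g₂ t)
  +-degree≤ zero    deg₁ deg₂ s t = +-cong (deg₁ s t) (deg₂ s t)
  +-degree≤ (suc n) {g₁} {g₂} deg₁ deg₂ r with deg₁ r | deg₂ r
  ... | h₁ , deg-h₁ , g₁≈ | h₂ , deg-h₂ , g₂≈ =
    (λ t → h₁ t + h₂ t) , +-degree≤ n deg-h₁ deg-h₂ ,
    λ t d t≈r+d → trans (+-cong (g₁≈ t d t≈r+d) (g₂≈ t d t≈r+d)) (regroup (g₁ r) (h₁ t) (g₂ r) (h₂ t) d)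
    where
    regroup : ∀ x y x′ y′ d → (x + d * y) + (x′ + d * y′) ≈ (x + x′) + d * (y + y′)
    regroup = solve 5 (λ x y x′ y′ d → (x :+ d :* y) :+ (x′ :+ d :* y′) := (x :+ x′) :+ d :* (y :+ y′)) refl

  linear*-degree≤ : ∀ n a b {g} → HasDegree≤ n g → HasDegree≤ (suc n) (λ t → (a + t * b) * g t)
  linear*-degree≤ zero a b {g} deg r = (λ _ → b * g r) , const-degree≤ zero _ , λ t d t≈r+d → begin
    (a + t * b) * g t              ≈⟨ *-cong (+-congˡ (*-congʳ t≈r+d)) (deg t r) ⟩
    (a + (r + d) * b) * g r        ≈⟨ expand a r d b (g r) ⟩
    (a + r * b) * g r + d * (b * g r) ∎
    where
    expand : ∀ a r d b x → (a + (r + d) * b) * x ≈ (a + r * b) * x + d * (b * x)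
    expand = solve 5 (λ a r d b x → (a :+ (r :+ d) :* b) :* x := (a :+ r :* b) :* x :+ d :* (b :* x)) refl
  linear*-degree≤ (suc n) a b {g} deg r with deg r
  ... | h , deg-h , g≈ =
    (λ t → (a + t * b) * h t + b * g r) ,
    +-degree≤ (suc n) (linear*-degree≤ n a b deg-h) (const-degree≤ (suc n) _) ,
    λ t d t≈r+d → begin
      (a + t * b) * g t                   ≈⟨ *-congˡ (g≈ t d t≈r+d) ⟩
      (a + t * b) * (g r + d * h t)       ≈⟨ expand a t r d b (g r) (h t) t≈r+d ⟩
      (a + r * b) * g r + d * ((a + t * b) * h t + b * g r) ∎
    where
    expand : ∀ a t r d b x y → t ≈ r + d →
             (a + t * b) * (x + d * y) ≈ (a + r * b) * x + d * ((a + t * b) * y + b * x)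
    expand a t r d b x y t≈r+d = begin
      (a + t * b) * (x + d * y)           ≈⟨ *-congʳ (+-congˡ (*-congʳ t≈r+d)) ⟩
      (a + (r + d) * b) * (x + d * y)     ≈⟨ identity a r d b x y ⟩
      (a + r * b) * x + d * ((a + (r + d) * b) * y + b * x)
                                          ≈⟨ +-congˡ (*-congˡ (+-congʳ (*-congʳ (+-congˡ (*-congʳ t≈r+d))))) ⟨
      (a + r * b) * x + d * ((a + t * b) * y + b * x) ∎
      where
      identity : ∀ a r d b x y →
                 (a + (r + d) * b) * (x + d * y) ≈ (a + r * b) * x + d * ((a + (r + d) * b) * y + b * x)
      identity = solve 6 (λ a r d b x y →
        (a :+ (r :+ d) :* b) :* (x :+ d :* y) := (a :+ r :* b) :* x :+ d :* ((a :+ (r :+ d) :* b) :* y :+ b :* x)) refl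

  ∏-linear-degree≤ : ∀ m (a b : Fin m → Carrier) → HasDegree≤ m (λ t → ∏ (λ j → a j + t * b j))
  ∏-linear-degree≤ zero    a b = const-degree≤ 0 1#
  ∏-linear-degree≤ (suc m) a b = linear*-degree≤ m (a zero) (b zero) (∏-linear-degree≤ m (a ∘ suc) (b ∘ suc))

  constant-at-suc-points⇒constant : ∀ n {g} → HasDegree≤ n g →
    (ts : Fin (suc n) → Carrier) → (∀ i j → ts i ≈ ts j → i ≡ j) →
    ∀ {a} → (∀ i → g (ts i) ≈ a) → ∀ t → g t ≈ a
  constant-at-suc-points⇒constant zero    deg ts _ g≈a t = trans (deg t (ts zero)) (g≈a zero)
  constant-at-suc-points⇒constant (suc n) {g} deg ts ts-inj {a} g≈a t with deg (ts zero)
  ... | h , deg-h , g≈ = begin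
    g t                    ≈⟨ g≈ t (t - r) (t≈r+[t-r] t r) ⟩
    g r + (t - r) * h t    ≈⟨ +-cong (g≈a zero) (*-congˡ (h≈0 t)) ⟩
    a + (t - r) * 0#       ≈⟨ +-congˡ (zeroʳ _) ⟩
    a + 0#                 ≈⟨ +-identityʳ a ⟩
    a                      ∎
    where
    r : Carrier
    r = ts zero
    h-root : ∀ i → h (ts (suc i)) ≈ 0#
    h-root i = x≉0∧xy≈0⇒y≈0 s-r≉0 (+-cancelˡ a _ _ (begin
        a + (s - r) * h s      ≈⟨ +-congʳ (g≈a zero) ⟨
        g r + (s - r) * h s    ≈⟨ g≈ s (s - r) (t≈r+[t-r] s r) ⟨
        g s                    ≈⟨ g≈a (suc i) ⟩
        a                      ≈⟨ +-identityʳ a ⟨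
        a + 0#                 ∎))
      where
      s : Carrier
      s = ts (suc i)
      s-r≉0 : ¬ (s - r ≈ 0#)
      s-r≉0 s-r≈0 with () ← ts-inj (suc i) zero (x∙y⁻¹≈ε⇒x≈y s r s-r≈0)
    h≈0 : ∀ t → h t ≈ 0#
    h≈0 = constant-at-suc-points⇒constant n deg-h (ts ∘ suc)
            (λ i j e → suc-injective (ts-inj (suc i) (suc j) e)) h-root

  module _ (_≟0 : ∀ x → Dec (x ≈ 0#)) where

    -- The product has degree ≤ m, so it is ≈ 1 everywhere; but if w j ≉ 0 its j-th factor
    -- vanishes at t = − p j / w j.
    ∏-affine≈1-at-suc-points⇒direction≈0 : ∀ m (p w : Fin m → Carrier) →
      (ts : Fin (suc m) → Carrier) → (∀ i j → ts i ≈ ts j → i ≡ j) →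
      (∀ i → ∏ (λ j → p j + ts i * w j) ≈ 1#) → ∀ j → w j ≈ 0#
    ∏-affine≈1-at-suc-points⇒direction≈0 m p w ts ts-inj ∏≈1 j with w j ≟0
    ... | yes wj≈0 = wj≈0
    ... | no wj≉0 with inverse (w j) wj≉0
    ...   | wj⁻¹ , wjwj⁻¹≈1 = ⊥-elim (0≉1 (trans (sym (∏≈0 _ j factor≈0)) (∏≈1-everywhere t₀)))
      where
      ∏≈1-everywhere : ∀ t → ∏ (λ j → p j + t * w j) ≈ 1#
      ∏≈1-everywhere = constant-at-suc-points⇒constant m (∏-linear-degree≤ m p w) ts ts-inj ∏≈1
      t₀ : Carrier
      t₀ = - p j * wj⁻¹
      factor≈0 : p j + t₀ * w j ≈ 0#
      factor≈0 = begin
        p j + t₀ * w j             ≈⟨ +-congˡ (*-assoc (- p j) wj⁻¹ (w j)) ⟩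
        p j + - p j * (wj⁻¹ * w j) ≈⟨ +-congˡ (*-congˡ (trans (*-comm wj⁻¹ (w j)) wjwj⁻¹≈1)) ⟩
        p j + - p j * 1#           ≈⟨ +-congˡ (*-identityʳ (- p j)) ⟩
        p j + - p j                ≈⟨ -‿inverseʳ (p j) ⟩
        0#                         ∎

  module _ (n : ℕ) where
    open ProjectiveSpace F n

    -- The affine part (x₀ = 1) of the hypersurface x₁ x₂ ⋯ xₙ = x₀ⁿ.
    OnHypersurface : Vector → Set ℓ
    OnHypersurface x = x zero ≈ 1# × ∏ (x ∘ suc) ≈ 1#

    Distinct : ∀ {N} → (Fin N → Vector) → Set ℓ
    Distinct P = ∀ i j → (∀ k → P i k ≈ P j k) → i ≡ j

    IsPointSet⇒Distinct : ∀ {N} {P : Fin N → Vector} → IsPointSet N P → Distinct P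
    IsPointSet⇒Distinct (_ , non-proportional) i j Pᵢ≈Pⱼ =
      non-proportional i j (1# , λ k → trans (Pᵢ≈Pⱼ k) (sym (*-identityˡ _)))

    LinIndep-sym : ∀ {u v} → LinIndep u v → LinIndep v u
    LinIndep-sym indep a b av+bu≈0 =
      let (b≈0 , a≈0) = indep b a (λ i → trans (+-comm _ _) (av+bu≈0 i)) in a≈0 , b≈0

    InSpan-sym : ∀ {u v x} → InSpan u v x → InSpan v u x
    InSpan-sym (a , b , x≈au+bv) = b , a , λ i → trans (x≈au+bv i) (+-comm _ _)

    -- With u₀ invertible, the line ⟨u, v⟩ meets x₀ = 1 in the affine line p + b·w, where
    -- p = u / u₀ and w = v − (v₀ / u₀)·u; the point a·u + b·v has parameter b.
    module AffineChart (u v : Vector) (u₀⁻¹ : Carrier) (u₀u₀⁻¹≈1 : u zero * u₀⁻¹ ≈ 1#) where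
      k : Carrier
      k = - (v zero * u₀⁻¹)

      v₀u₀⁻¹+k≈0 : v zero * u₀⁻¹ + k ≈ 0#
      v₀u₀⁻¹+k≈0 = -‿inverseʳ _

      p w : Vector
      p i = u₀⁻¹ * u i
      w i = v i + k * u i

      w₀≈0 : w zero ≈ 0#
      w₀≈0 = begin
        v zero + k * u zero                  ≈⟨ +-congʳ (*-identityʳ (v zero)) ⟨
        v zero * 1# + k * u zero             ≈⟨ +-congʳ (*-congˡ u₀u₀⁻¹≈1) ⟨
        v zero * (u zero * u₀⁻¹) + k * u zero ≈⟨ regroup (v zero) (u zero) u₀⁻¹ k ⟩
        (v zero * u₀⁻¹ + k) * u zero         ≈⟨ *-congʳ v₀u₀⁻¹+k≈0 ⟩
        0# * u zero                          ≈⟨ zeroˡ (u zero) ⟩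
        0#                                   ∎
        where
        regroup : ∀ v₀ u₀ u₀⁻¹ k → v₀ * (u₀ * u₀⁻¹) + k * u₀ ≈ (v₀ * u₀⁻¹ + k) * u₀
        regroup = solve 4 (λ v₀ u₀ u₀⁻¹ k → v₀ :* (u₀ :* u₀⁻¹) :+ k :* u₀ := (v₀ :* u₀⁻¹ :+ k) :* u₀) refl

      affine : ∀ a b → a * u zero + b * v zero ≈ 1# → ∀ i → a * u i + b * v i ≈ p i + b * w i
      affine a b on-x₀≈1 i = begin
        a * u i + b * v i                   ≈⟨ +-congʳ (*-congʳ a≈u₀⁻¹+bk) ⟩
        (u₀⁻¹ + b * k) * u i + b * v i      ≈⟨ regroup u₀⁻¹ b k (u i) (v i) ⟩
        u₀⁻¹ * u i + b * (v i + k * u i)    ∎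
        where
        regroup : ∀ u₀⁻¹ b k uᵢ vᵢ → (u₀⁻¹ + b * k) * uᵢ + b * vᵢ ≈ u₀⁻¹ * uᵢ + b * (vᵢ + k * uᵢ)
        regroup = solve 5 (λ u₀⁻¹ b k uᵢ vᵢ → (u₀⁻¹ :+ b :* k) :* uᵢ :+ b :* vᵢ := u₀⁻¹ :* uᵢ :+ b :* (vᵢ :+ k :* uᵢ)) refl
        expand : ∀ a b u₀ v₀ u₀⁻¹ k → a * (u₀ * u₀⁻¹) + b * (v₀ * u₀⁻¹ + k) ≈ (a * u₀ + b * v₀) * u₀⁻¹ + b * k
        expand = solve 6 (λ a b u₀ v₀ u₀⁻¹ k →
          a :* (u₀ :* u₀⁻¹) :+ b :* (v₀ :* u₀⁻¹ :+ k) := (a :* u₀ :+ b :* v₀) :* u₀⁻¹ :+ b :* k) refl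
        a≈u₀⁻¹+bk : a ≈ u₀⁻¹ + b * k
        a≈u₀⁻¹+bk = begin
          a                                             ≈⟨ *-identityʳ a ⟨
          a * 1#                                        ≈⟨ *-congˡ u₀u₀⁻¹≈1 ⟨
          a * (u zero * u₀⁻¹)                           ≈⟨ +-identityʳ _ ⟨
          a * (u zero * u₀⁻¹) + 0#                      ≈⟨ +-congˡ (trans (*-congˡ v₀u₀⁻¹+k≈0) (zeroʳ b)) ⟨
          a * (u zero * u₀⁻¹) + b * (v zero * u₀⁻¹ + k) ≈⟨ expand a b (u zero) (v zero) u₀⁻¹ k ⟩
          (a * u zero + b * v zero) * u₀⁻¹ + b * k      ≈⟨ +-congʳ (trans (*-congʳ on-x₀≈1) (*-identityˡ u₀⁻¹)) ⟩
          u₀⁻¹ + b * k                                  ∎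

      w≈0⇒dependent : (∀ i → w i ≈ 0#) → ¬ LinIndep u v
      w≈0⇒dependent w≈0 indep = 0≉1 (sym (proj₂ (indep k 1# ku+v≈0)))
        where
        ku+v≈0 : ∀ i → k * u i + 1# * v i ≈ 0#
        ku+v≈0 i = trans (trans (+-comm _ _) (+-congʳ (*-identityˡ (v i)))) (w≈0 i)

    module _ (_≟0 : ∀ x → Dec (x ≈ 0#)) where

      hypersurface-meets-line≤n-chart : ∀ {u v} → LinIndep u v → ¬ (u zero ≈ 0#) →
        (P : Fin (suc n) → Vector) → (∀ i → OnHypersurface (P i)) → Distinct P →
        ¬ (∀ i → InSpan u v (P i))
      hypersurface-meets-line≤n-chart {u} {v} indep u₀≉0 P on-hypersurface distinct in-span
        with inverse (u zero) u₀≉0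
      ... | u₀⁻¹ , u₀u₀⁻¹≈1 = w≈0⇒dependent (λ { zero → w₀≈0 ; (suc j) → w-suc≈0 j }) indep
        where
        open AffineChart u v u₀⁻¹ u₀u₀⁻¹≈1
        b : Fin (suc n) → Carrier
        b i = proj₁ (proj₂ (in-span i))
        P≈p+bw : ∀ i k → P i k ≈ p k + b i * w k
        P≈p+bw i k with in-span i
        ... | aᵢ , bᵢ , Pᵢ≈aᵢu+bᵢv =
          trans (Pᵢ≈aᵢu+bᵢv k) (affine aᵢ bᵢ (trans (sym (Pᵢ≈aᵢu+bᵢv zero)) (proj₁ (on-hypersurface i))) k)
        b-injective : ∀ i j → b i ≈ b j → i ≡ j
        b-injective i j bᵢ≈bⱼ = distinct i j λ k →
          trans (P≈p+bw i k) (trans (+-congˡ (*-congʳ bᵢ≈bⱼ)) (sym (P≈p+bw j k)))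
        w-suc≈0 : ∀ j → w (suc j) ≈ 0#
        w-suc≈0 = ∏-affine≈1-at-suc-points⇒direction≈0 _≟0 n (p ∘ suc) (w ∘ suc) b b-injective
          (λ i → trans (∏-cong (λ j → sym (P≈p+bw i (suc j)))) (proj₂ (on-hypersurface i)))

      hypersurface-meets-line≤n : ∀ {u v} → LinIndep u v →
        (P : Fin (suc n) → Vector) → (∀ i → OnHypersurface (P i)) → Distinct P →
        ¬ (∀ i → InSpan u v (P i))
      hypersurface-meets-line≤n {u} {v} indep P on-hypersurface distinct in-span
        with u zero ≟0 | v zero ≟0
      ... | no u₀≉0 | _ =
        hypersurface-meets-line≤n-chart indep u₀≉0 P on-hypersurface distinct in-span
      ... | yes _ | no v₀≉0 =
        hypersurface-meets-line≤n-chart (LinIndep-sym indep) v₀≉0 P on-hypersurface distinct (InSpan-sym ∘ in-span)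
      ... | yes u₀≈0 | yes v₀≈0 with in-span zero
      ...   | a , b , P≈au+bv = 0≉1 (begin
        0#                    ≈⟨ +-identityʳ 0# ⟨
        0# + 0#               ≈⟨ +-cong (trans (*-congˡ u₀≈0) (zeroʳ a)) (trans (*-congˡ v₀≈0) (zeroʳ b)) ⟨
        a * u zero + b * v zero ≈⟨ P≈au+bv zero ⟨
        P zero zero           ≈⟨ proj₁ (on-hypersurface zero) ⟩
        1#                    ∎)

      hypersurface-point-set⇒AtMostOnEachLine : ∀ {N} (P : Fin N → Vector) → IsPointSet N P →
        (∀ k → OnHypersurface (P k)) → AtMostOnEachLine n N P
      hypersurface-point-set⇒AtMostOnEachLine P point-set on-hypersurface u v indep f f-injective =
        hypersurface-meets-line≤n indep (P ∘ f) (on-hypersurface ∘ f)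
          (λ i j Pfᵢ≈Pfⱼ → f-injective i j (IsPointSet⇒Distinct point-set (f i) (f j) Pfᵢ≈Pfⱼ))

  hypersurface-point-set : ∀ {r} m (e : Fin r → Carrier) → (∀ j → ¬ (e j ≈ 0#)) →
    (∀ i j → e i ≈ e j → i ≡ j) →
    Σ (Fin (r ^ m) → ProjectiveSpace.Vector F (suc m)) λ P →
      ProjectiveSpace.IsPointSet F (suc m) (r ^ m) P × (∀ k → OnHypersurface (suc m) (P k))
  hypersurface-point-set {r} m e e≉0 e-injective = P , (P≉0 , non-proportional) , on-hypersurface
    where
    x : Fin (r ^ m) → Fin m → Carrier
    x k = e ∘ finToFun k
    ∏x≉0 : ∀ k → ¬ (∏ (x k) ≈ 0#)
    ∏x≉0 k = ∏≉0 (x k) (e≉0 ∘ finToFun k)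
    P : Fin (r ^ m) → ProjectiveSpace.Vector F (suc m)
    P k zero          = 1#
    P k (suc zero)    = proj₁ (inverse (∏ (x k)) (∏x≉0 k))
    P k (suc (suc j)) = x k j
    on-hypersurface : ∀ k → OnHypersurface (suc m) (P k)
    on-hypersurface k = refl , trans (*-comm _ _) (proj₂ (inverse (∏ (x k)) (∏x≉0 k)))
    P≉0 : ∀ k → ¬ (∀ i → P k i ≈ 0#)
    P≉0 k P≈0 = 0≉1 (sym (P≈0 zero))
    non-proportional : ∀ k l → (Σ Carrier λ a → ∀ i → P k i ≈ a * P l i) → k ≡ l
    non-proportional k l (a , Pₖ≈aPₗ) = finToFun-injective λ j →
      e-injective _ _ (trans (Pₖ≈aPₗ (suc (suc j))) (trans (*-congʳ a≈1) (*-identityˡ _)))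
      where
      a≈1 : a ≈ 1#
      a≈1 = sym (trans (Pₖ≈aPₗ zero) (*-identityʳ a))

  HasOrder⇒≈-decidable : ∀ {q} → HasOrder F q → ∀ x y → Dec (x ≈ y)
  HasOrder⇒≈-decidable (e , e-injective , e-surjective) x y with e-surjective x | e-surjective y
  ... | i , eᵢ≈x | j , eⱼ≈y with i ≟ᶠ j
  ... | yes ≡.refl = yes (trans (sym eᵢ≈x) eⱼ≈y)
  ... | no i≢j     = no λ x≈y → i≢j (e-injective i j (trans eᵢ≈x (trans x≈y (sym eⱼ≈y))))

  nonzero-enumeration : ∀ {q} → HasOrder F (suc q) →
    Σ (Fin q → Carrier) λ e → (∀ j → ¬ (e j ≈ 0#)) × (∀ i j → e i ≈ e j → i ≡ j)
  nonzero-enumeration (e , e-injective , e-surjective) with e-surjective 0#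
  ... | i₀ , eᵢ₀≈0 =
    e ∘ punchIn i₀ ,
    (λ j eⱼ≈0 → punchInᵢ≢i i₀ j (e-injective _ _ (trans eⱼ≈0 (sym eᵢ₀≈0)))) ,
    (λ i j eᵢ≈eⱼ → punchIn-injective i₀ i j (e-injective _ _ eᵢ≈eⱼ))

theorem2 : ∀ {c ℓ : Level} (n q : ℕ) → n ≥ 2 → IsPrimePower q →
    (F : Field c ℓ) → HasOrder F q →
    Σ (Fin ((q ∸ 1) ^ (n ∸ 1)) → ProjectiveSpace.Vector F n) λ P →
      ProjectiveSpace.IsPointSet F n ((q ∸ 1) ^ (n ∸ 1)) P ×
      ProjectiveSpace.AtMostOnEachLine F n n ((q ∸ 1) ^ (n ∸ 1)) P
theorem2 zero    _       ()
theorem2 (suc m) zero    _ _ F (_ , _ , e-surjective) with () ← proj₁ (e-surjective (Field.0# F))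
theorem2 (suc m) (suc q) _ _ F order =
  let e , e≉0 , e-injective      = nonzero-enumeration F order
      P , point-set , on-surface = hypersurface-point-set F m e e≉0 e-injective
  in  P , point-set ,
      hypersurface-point-set⇒AtMostOnEachLine F (suc m) (λ x → HasOrder⇒≈-decidable F order x (Field.0# F))
        P point-set on-surface
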